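{- Let $n\in\mathbb{N}$. For $m\in\mathbb{N}$ let $\mathbb{P}(m)$ denote the set of prime divisors of $m$. Then $$\bigcup_{m=1}^{n-1}\mathbb{P}(m)=\bigcup_{(a_1,\ldots,a_n)\in\mathcal{A}_n}\mathbb{P}(c_{(a_1,\ldots,a_n)}).$$
   Context: For $n\in\mathbb{N}$ and indeterminates $x_1,\ldots,x_n$, let $p_n=x_1(x_1+x_2)\cdots(x_1+x_2+\cdots+x_n)$. Let $\mathbb{N}_0=\mathbb{N}\cup\{0\}$ and $\mathcal{A}_n=\{(a_1,\ldots,a_n)\in\mathbb{N}_0^n : \sum_{i=k+1}^n a_i\le n-k \text{ for all } 1\le k\le n-1,\ \sum_{i=1}^n a_i=n\}$. For $a\in\mathcal{A}_n$, $c_a$ denotes the coefficient of $x_1^{a_1}\cdots x_n^{a_n}$ in the expansion of $p_n$. -}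

module Defs where

open import Data.Nat using (ℕ; zero; suc; _+_; _∸_; _≤_; _≤ᵇ_; pred)
open import Data.Fin using (Fin; toℕ; _≟_)
open import Data.Bool using (Bool; true; false; if_then_else_)
open import Data.Product using (_×_)
open import Relation.Nullary.Decidable using (⌊_⌋)
open import Relation.Binary.PropositionalEquality using (_≡_)

-- Exponent vectors a = (a_1,…,a_n) are functions Fin n → ℕ
-- (0-indexed: position i : Fin n stands for a_{i+1}).

ΣFin : ∀ {n} → (Fin n → ℕ) → ℕ
ΣFin {zero}  f = 0
ΣFin {suc n} f = f Data.Fin.zero + ΣFin (λ i → f (Data.Fin.suc i))

-- Σ_{i=k+1}^{n} a_i  (0-indexed: positions i with toℕ i ≥ k)
suffixSum : ∀ {n} → (Fin n → ℕ) → ℕ → ℕ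
suffixSum a k = ΣFin (λ i → if k ≤ᵇ toℕ i then a i else 0)

InA : (n : ℕ) → (Fin n → ℕ) → Set
InA n a = ((k : ℕ) → 1 ≤ k → k ≤ n ∸ 1 → suffixSum a k ≤ n ∸ k)
        × ΣFin a ≡ n

decAt : ∀ {n} → (Fin n → ℕ) → Fin n → (Fin n → ℕ)
decAt a i j = if ⌊ i ≟ j ⌋ then pred (a j) else a j

isZero : ℕ → Bool
isZero zero = true
isZero (suc _) = false

allZero : ∀ {n} → (Fin n → ℕ) → Bool
allZero {zero} a = true
allZero {suc n} a = if isZero (a Data.Fin.zero) then allZero (λ i → a (Data.Fin.suc i)) else false

-- coeff n k a = coefficient of x_1^{a_1}⋯x_n^{a_n} in the polynomial
--   p_k = x_1 (x_1+x_2) ⋯ (x_1+⋯+x_k)   (in the n variables x_1,…,x_n, k ≤ n),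
-- computed by polynomial multiplication: p_0 = 1 and
--   p_{k+1} = p_k · (x_1+⋯+x_{k+1}),
-- so [x^a] p_{k+1} = Σ_{i ≤ k+1, a_i ≥ 1} [x^{a - e_i}] p_k.
coeff : (n : ℕ) → ℕ → (Fin n → ℕ) → ℕ
coeff n zero    a = if allZero a then 1 else 0
coeff n (suc k) a =
  ΣFin (λ i → if (toℕ i ≤ᵇ k) then (if isZero (a i) then 0 else coeff n k (decAt a i)) else 0)

c : (n : ℕ) → (Fin n → ℕ) → ℕ
c n a = coeff n n a

-- Expanding p_n one linear factor at a time, [x^a] p_{k+1} = Σ_{i ≤ k+1} [x^{a − e_i}] p_k, and a
-- telescoping identity for the ballot products ∏_j (a₁ + ⋯ + a_j − j + 1) show
--   c_a · ∏ aᵢ! = ∏_{j=1}^{n} (a₁ + ⋯ + a_j − j + 1).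
-- For a ∈ 𝒜_n the j-th factor lies in [1, n − j + 1], so a prime p ≥ n divides c_a only if
-- a = (n, 0, …, 0), where c_a = 1. Conversely every m with 1 ≤ m ≤ n − 1 is itself some c_a.
module Submission where

open import Defs
open import Data.Bool using (true; if_then_else_)
open import Data.Fin using (Fin; toℕ; _≟_) renaming (zero to fz; suc to fs)
open import Data.Integer using (ℤ; +_; 0ℤ; 1ℤ)
  renaming (_+_ to _+ᶻ_; _*_ to _*ᶻ_; _-_ to _-ᶻ_)
import Data.Integer.Properties as ℤ
import Algebra.Properties.CommutativeSemigroup ℤ.*-commutativeSemigroup as ℤ*-CS
open import Data.Integer.Tactic.RingSolver using (solve-∀)
open import Data.Nat using (ℕ; zero; suc; _+_; _*_; _∸_; _≤_; _<_; z≤n; s≤s; z<s; s<s; s<s⁻¹;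
  _≤ᵇ_; _<ᵇ_; pred; _!; >-nonZero; >-nonZero⁻¹)
open import Data.Nat.Properties hiding (_≟_)
import Algebra.Properties.CommutativeSemigroup *-commutativeSemigroup as *-CS
import Algebra.Properties.CommutativeSemigroup +-commutativeSemigroup as +-CS
open import Data.Nat.Divisibility using (_∣_; _∤_; ∣1⇒≡1; >⇒∤; ∣⇒≤; ∣-refl; ∣-reflexive; ∣m⇒∣m*n)
open import Data.Nat.Primality using (Prime; euclidsLemma; ¬prime[1]; prime⇒nonZero)
open import Data.Product using (_×_; _,_; proj₁; proj₂; Σ-syntax)
open import Data.Sum using (inj₁; inj₂; [_,_]′)
open import Data.Vec.Functional using (_∷_)
open import Function using (_∘_)
open import Function.Bundles using (_⇔_; mk⇔)
open import Relation.Nullary.Negation using (contradiction)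
open import Relation.Binary.PropositionalEquality
open import Relation.Nullary.Decidable using (yes; no)
open ≡-Reasoning

head₀ : ∀ {n} → (Fin n → ℕ) → ℕ
head₀ {zero}  a = 0
head₀ {suc n} a = a fz

tail₀ : ∀ {n} → (Fin n → ℕ) → Fin (pred n) → ℕ
tail₀ {zero}  a = a
tail₀ {suc n} a = a ∘ fs

ΣFin-cong : ∀ {n} {f g : Fin n → ℕ} → (∀ i → f i ≡ g i) → ΣFin f ≡ ΣFin g
ΣFin-cong {zero}  h = refl
ΣFin-cong {suc n} h = cong₂ _+_ (h fz) (ΣFin-cong (h ∘ fs))

ΣFin-zeros : ∀ {n} {f : Fin n → ℕ} → (∀ i → f i ≡ 0) → ΣFin f ≡ 0
ΣFin-zeros {zero}  h = refl
ΣFin-zeros {suc n} h rewrite h fz = ΣFin-zeros (h ∘ fs)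

ΣFin≡0⇒zeros : ∀ {n} (f : Fin n → ℕ) → ΣFin f ≡ 0 → ∀ i → f i ≡ 0
ΣFin≡0⇒zeros f e fz     = m+n≡0⇒m≡0 (f fz) e
ΣFin≡0⇒zeros f e (fs i) = ΣFin≡0⇒zeros (f ∘ fs) (m+n≡0⇒n≡0 (f fz) e) i

decAt-fs : ∀ {n} (a : Fin (suc n) → ℕ) i j → decAt a (fs i) (fs j) ≡ decAt (a ∘ fs) i j
decAt-fs a i j with i ≟ j
... | yes _ = refl
... | no  _ = refl

ΣFin-decAt : ∀ {n} (a : Fin n → ℕ) i {x} → a i ≡ suc x → ΣFin a ≡ suc (ΣFin (decAt a i))
ΣFin-decAt a fz     e rewrite e = refl
ΣFin-decAt a (fs i) e = begin
  a fz + ΣFin (a ∘ fs)                      ≡⟨ cong (λ z → a fz + z) (ΣFin-decAt (a ∘ fs) i e) ⟩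
  a fz + suc (ΣFin (decAt (a ∘ fs) i))      ≡⟨ +-suc (a fz) _ ⟩
  suc (a fz + ΣFin (decAt (a ∘ fs) i))      ≡⟨ cong (λ z → suc (a fz + z)) (ΣFin-cong (sym ∘ decAt-fs a i)) ⟩
  suc (a fz + ΣFin (decAt a (fs i) ∘ fs))   ∎

Πfactorial : ∀ {n} → (Fin n → ℕ) → ℕ
Πfactorial {zero}  a = 1
Πfactorial {suc n} a = a fz ! * Πfactorial (a ∘ fs)

Πfactorial-cong : ∀ {n} {f g : Fin n → ℕ} → (∀ i → f i ≡ g i) → Πfactorial f ≡ Πfactorial g
Πfactorial-cong {zero}  h = refl
Πfactorial-cong {suc n} h = cong₂ (λ x y → x ! * y) (h fz) (Πfactorial-cong (h ∘ fs))

Πfactorial-zeros : ∀ {n} {f : Fin n → ℕ} → (∀ i → f i ≡ 0) → Πfactorial f ≡ 1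
Πfactorial-zeros {zero}  h = refl
Πfactorial-zeros {suc n} h rewrite h fz = trans (+-identityʳ _) (Πfactorial-zeros (h ∘ fs))

Πfactorial-decAt : ∀ {n} (a : Fin n → ℕ) i {x} → a i ≡ suc x → Πfactorial a ≡ suc x * Πfactorial (decAt a i)
Πfactorial-decAt a fz {x} e rewrite e = *-assoc (suc x) (x !) _
Πfactorial-decAt a (fs i) {x} e = begin
  a fz ! * Πfactorial (a ∘ fs)                           ≡⟨ cong (a fz ! *_) (Πfactorial-decAt (a ∘ fs) i e) ⟩
  a fz ! * (suc x * Πfactorial (decAt (a ∘ fs) i))       ≡⟨ *-CS.x∙yz≈y∙xz (a fz !) (suc x) _ ⟩
  suc x * (a fz ! * Πfactorial (decAt (a ∘ fs) i))       ≡⟨ cong (λ z → suc x * (a fz ! * z)) (Πfactorial-cong (sym ∘ decAt-fs a i)) ⟩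
  suc x * (a fz ! * Πfactorial (decAt a (fs i) ∘ fs))    ∎

allZero-zeros : ∀ {n} (a : Fin n → ℕ) → (∀ i → a i ≡ 0) → allZero a ≡ true
allZero-zeros {zero}  a h = refl
allZero-zeros {suc n} a h rewrite h fz = allZero-zeros (a ∘ fs) (h ∘ fs)

<ᵇ-suc : ∀ m n → (m <ᵇ suc n) ≡ (m ≤ᵇ n)
<ᵇ-suc zero    n = refl
<ᵇ-suc (suc m) n = refl

sumℤ : ∀ {n} → ℕ → (Fin n → ℤ) → ℤ
sumℤ zero          f = 0ℤ
sumℤ {zero}  (suc m) f = 0ℤ
sumℤ {suc n} (suc m) f = f fz +ᶻ sumℤ m (f ∘ fs)

sumℤ-cong : ∀ {n} m {f g : Fin n → ℤ} → (∀ i → f i ≡ g i) → sumℤ m f ≡ sumℤ m g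
sumℤ-cong zero            h = refl
sumℤ-cong {zero}  (suc m) h = refl
sumℤ-cong {suc n} (suc m) h = cong₂ _+ᶻ_ (h fz) (sumℤ-cong m (h ∘ fs))

sumℤ-*ˡ : ∀ {n} m x (f : Fin n → ℤ) → sumℤ m (λ i → x *ᶻ f i) ≡ x *ᶻ sumℤ m f
sumℤ-*ˡ zero            x f = sym (ℤ.*-zeroʳ x)
sumℤ-*ˡ {zero}  (suc m) x f = sym (ℤ.*-zeroʳ x)
sumℤ-*ˡ {suc n} (suc m) x f = begin
  x *ᶻ f fz +ᶻ sumℤ m (λ i → x *ᶻ f (fs i))  ≡⟨ cong (x *ᶻ f fz +ᶻ_) (sumℤ-*ˡ m x (f ∘ fs)) ⟩
  x *ᶻ f fz +ᶻ x *ᶻ sumℤ m (f ∘ fs)          ≡⟨ ℤ.*-distribˡ-+ x (f fz) _ ⟨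
  x *ᶻ (f fz +ᶻ sumℤ m (f ∘ fs))             ∎

-- ballotProdℤ s m a = ∏_{j=1}^{m} (s + a₁ + ⋯ + a_j − j + 1), entries of a beyond n counting as 0.
ballotProdℤ : ∀ {n} → ℤ → ℕ → (Fin n → ℕ) → ℤ
ballotProdℤ s zero    a = 1ℤ
ballotProdℤ s (suc m) a = (s +ᶻ + head₀ a) *ᶻ ballotProdℤ (s +ᶻ + head₀ a -ᶻ 1ℤ) m (tail₀ a)

ballotProdℤ-cong : ∀ {n} m {s s′} {a b : Fin n → ℕ} →
  s ≡ s′ → (∀ i → a i ≡ b i) → ballotProdℤ s m a ≡ ballotProdℤ s′ m b
ballotProdℤ-cong zero                        refl h = refl
ballotProdℤ-cong {zero}  (suc m) {s}         refl h = cong ((s +ᶻ 0ℤ) *ᶻ_) (ballotProdℤ-cong m refl h)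
ballotProdℤ-cong {suc n} (suc m) {s} {b = b} refl h rewrite h fz =
  cong ((s +ᶻ + b fz) *ᶻ_) (ballotProdℤ-cong m refl (h ∘ fs))

ballotProdℤ-decAt-fz : ∀ {n} s m (a : Fin (suc n) → ℕ) →
  + a fz *ᶻ ballotProdℤ s m (decAt a fz) ≡ + a fz *ᶻ ballotProdℤ (s -ᶻ 1ℤ) m a
ballotProdℤ-decAt-fz s zero    a = refl
ballotProdℤ-decAt-fz s (suc m) a with a fz
... | zero  = refl
... | suc x = cong (+ suc x *ᶻ_) (cong₂ _*ᶻ_ shift (ballotProdℤ-cong m (cong (_-ᶻ 1ℤ) shift) λ _ → refl))
  where
  shift : s +ᶻ + x ≡ s -ᶻ 1ℤ +ᶻ + suc x
  shift = ring s (+ x)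
    where ring : ∀ s y → s +ᶻ y ≡ s -ᶻ 1ℤ +ᶻ (1ℤ +ᶻ y)
          ring = solve-∀

-- The sum telescopes: writing f_j, g_j for the j-th factors of ballotProdℤ s and ballotProdℤ (s − 1)
-- and g₀ = s, one has aᵢ = fᵢ − g_{i−1}, so the i-th term is
-- f₁⋯fᵢ gᵢ⋯g_m − f₁⋯f_{i−1} g_{i−1}⋯g_m.
ballotProdℤ-pascal : ∀ {n} s m (a : Fin n → ℕ) →
  sumℤ (suc m) (λ i → + a i *ᶻ ballotProdℤ s m (decAt a i))
    ≡ ballotProdℤ s (suc m) a -ᶻ s *ᶻ ballotProdℤ (s -ᶻ 1ℤ) m a
ballotProdℤ-pascal {zero} s m a = sym (begin
    (s +ᶻ 0ℤ) *ᶻ ballotProdℤ (s +ᶻ 0ℤ -ᶻ 1ℤ) m a -ᶻ s *ᶻ ballotProdℤ (s -ᶻ 1ℤ) m a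
  ≡⟨ cong (λ z → z *ᶻ ballotProdℤ (z -ᶻ 1ℤ) m a -ᶻ s *ᶻ ballotProdℤ (s -ᶻ 1ℤ) m a) (ℤ.+-identityʳ s) ⟩
    s *ᶻ ballotProdℤ (s -ᶻ 1ℤ) m a -ᶻ s *ᶻ ballotProdℤ (s -ᶻ 1ℤ) m a
  ≡⟨ ℤ.+-inverseʳ (s *ᶻ ballotProdℤ (s -ᶻ 1ℤ) m a) ⟩
    0ℤ ∎)
ballotProdℤ-pascal {suc n} s zero a = ring s (+ a fz)
  where ring : ∀ s A → A *ᶻ 1ℤ +ᶻ 0ℤ ≡ (s +ᶻ A) *ᶻ 1ℤ -ᶻ s *ᶻ 1ℤ
        ring = solve-∀
ballotProdℤ-pascal {suc n} s (suc m) a = begin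
    A *ᶻ ballotProdℤ s (suc m) (decAt a fz)
      +ᶻ sumℤ (suc m) (λ i → + a (fs i) *ᶻ ballotProdℤ s (suc m) (decAt a (fs i)))
  ≡⟨ cong₂ _+ᶻ_ (ballotProdℤ-decAt-fz s (suc m) a) tail-sum ⟩
    A *ᶻ ((s -ᶻ 1ℤ +ᶻ A) *ᶻ ballotProdℤ (s -ᶻ 1ℤ +ᶻ A -ᶻ 1ℤ) m tl) +ᶻ (s +ᶻ A) *ᶻ (W -ᶻ s′ *ᶻ U)
  ≡⟨ cong (λ z → A *ᶻ ((s -ᶻ 1ℤ +ᶻ A) *ᶻ z) +ᶻ (s +ᶻ A) *ᶻ (W -ᶻ s′ *ᶻ U)) same-shift ⟩
    A *ᶻ ((s -ᶻ 1ℤ +ᶻ A) *ᶻ U) +ᶻ (s +ᶻ A) *ᶻ (W -ᶻ s′ *ᶻ U)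
  ≡⟨ recombine s A W U ⟩
    (s +ᶻ A) *ᶻ W -ᶻ s *ᶻ ((s -ᶻ 1ℤ +ᶻ A) *ᶻ U)
  ≡⟨ cong (λ z → (s +ᶻ A) *ᶻ W -ᶻ s *ᶻ ((s -ᶻ 1ℤ +ᶻ A) *ᶻ z)) same-shift ⟨
    (s +ᶻ A) *ᶻ W -ᶻ s *ᶻ ((s -ᶻ 1ℤ +ᶻ A) *ᶻ ballotProdℤ (s -ᶻ 1ℤ +ᶻ A -ᶻ 1ℤ) m tl)
  ∎
  where
  tl : Fin n → ℕ
  tl = a ∘ fs

  A s′ W U : ℤ
  A  = + a fz
  s′ = s +ᶻ A -ᶻ 1ℤ
  W  = ballotProdℤ s′ (suc m) tl
  U  = ballotProdℤ (s′ -ᶻ 1ℤ) m tl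

  same-shift : ballotProdℤ (s -ᶻ 1ℤ +ᶻ A -ᶻ 1ℤ) m tl ≡ U
  same-shift = ballotProdℤ-cong m (ring s A) λ _ → refl
    where ring : ∀ s A → s -ᶻ 1ℤ +ᶻ A -ᶻ 1ℤ ≡ s +ᶻ A -ᶻ 1ℤ -ᶻ 1ℤ
          ring = solve-∀

  recombine : ∀ s A W U → A *ᶻ ((s -ᶻ 1ℤ +ᶻ A) *ᶻ U) +ᶻ (s +ᶻ A) *ᶻ (W -ᶻ (s +ᶻ A -ᶻ 1ℤ) *ᶻ U)
                        ≡ (s +ᶻ A) *ᶻ W -ᶻ s *ᶻ ((s -ᶻ 1ℤ +ᶻ A) *ᶻ U)
  recombine = solve-∀

  tail-sum : sumℤ (suc m) (λ i → + a (fs i) *ᶻ ballotProdℤ s (suc m) (decAt a (fs i)))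
           ≡ (s +ᶻ A) *ᶻ (W -ᶻ s′ *ᶻ U)
  tail-sum = begin
      sumℤ (suc m) (λ i → + a (fs i) *ᶻ ballotProdℤ s (suc m) (decAt a (fs i)))
    ≡⟨ sumℤ-cong (suc m) (λ i → cong (λ z → + a (fs i) *ᶻ ((s +ᶻ A) *ᶻ z))
                                      (ballotProdℤ-cong m refl (decAt-fs a i))) ⟩
      sumℤ (suc m) (λ i → + tl i *ᶻ ((s +ᶻ A) *ᶻ ballotProdℤ s′ m (decAt tl i)))
    ≡⟨ sumℤ-cong (suc m) (λ i → ℤ*-CS.x∙yz≈y∙xz (+ tl i) (s +ᶻ A) _) ⟩
      sumℤ (suc m) (λ i → (s +ᶻ A) *ᶻ (+ tl i *ᶻ ballotProdℤ s′ m (decAt tl i)))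
    ≡⟨ sumℤ-*ˡ (suc m) (s +ᶻ A) (λ i → + tl i *ᶻ ballotProdℤ s′ m (decAt tl i)) ⟩
      (s +ᶻ A) *ᶻ sumℤ (suc m) (λ i → + tl i *ᶻ ballotProdℤ s′ m (decAt tl i))
    ≡⟨ cong ((s +ᶻ A) *ᶻ_) (ballotProdℤ-pascal s′ m tl) ⟩
      (s +ᶻ A) *ᶻ (W -ᶻ s′ *ᶻ U)
    ∎

pos-+-*ʳ : ∀ x y P → + ((x + y) * P) ≡ + (x * P) +ᶻ + (y * P)
pos-+-*ʳ x y P = trans (cong +_ (*-distribʳ-+ P x y)) (ℤ.pos-+ (x * P) (y * P))

ΣFin-≤ᵇ*≡sumℤ : ∀ {n} k (g : Fin n → ℕ) (h : Fin n → ℤ) P → (∀ i → + (g i * P) ≡ h i) →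
  + (ΣFin (λ i → if toℕ i ≤ᵇ k then g i else 0) * P) ≡ sumℤ (suc k) h
ΣFin-≤ᵇ*≡sumℤ {zero}  k       g h P gh = refl
ΣFin-≤ᵇ*≡sumℤ {suc n} zero    g h P gh = begin
    + ((g fz + ΣFin {n} (λ i → 0)) * P)  ≡⟨ cong (λ z → + ((g fz + z) * P)) (ΣFin-zeros {n} λ _ → refl) ⟩
    + ((g fz + 0) * P)                   ≡⟨ cong (λ z → + (z * P)) (+-identityʳ (g fz)) ⟩
    + (g fz * P)                         ≡⟨ gh fz ⟩
    h fz                                 ≡⟨ ℤ.+-identityʳ (h fz) ⟨
    h fz +ᶻ 0ℤ                           ∎
ΣFin-≤ᵇ*≡sumℤ {suc n} (suc k) g h P gh = begin
    + ((g fz + ΣFin (λ i → if toℕ i <ᵇ suc k then g (fs i) else 0)) * P)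
  ≡⟨ cong (λ z → + ((g fz + z) * P))
          (ΣFin-cong λ i → cong (λ b → if b then g (fs i) else 0) (<ᵇ-suc (toℕ i) k)) ⟩
    + ((g fz + ΣFin (λ i → if toℕ i ≤ᵇ k then g (fs i) else 0)) * P)
  ≡⟨ pos-+-*ʳ (g fz) _ P ⟩
    + (g fz * P) +ᶻ + (ΣFin (λ i → if toℕ i ≤ᵇ k then g (fs i) else 0) * P)
  ≡⟨ cong₂ _+ᶻ_ (gh fz) (ΣFin-≤ᵇ*≡sumℤ k (g ∘ fs) (h ∘ fs) P (gh ∘ fs)) ⟩
    h fz +ᶻ sumℤ (suc k) (h ∘ fs)
  ∎

coeff*Πfactorial≡ballotProdℤ : ∀ n k (a : Fin n → ℕ) → ΣFin a ≡ k →
  + (coeff n k a * Πfactorial a) ≡ ballotProdℤ 0ℤ k a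
coeff*Πfactorial≡ballotProdℤ n zero a Σa≡0
  rewrite allZero-zeros a (ΣFin≡0⇒zeros a Σa≡0) | Πfactorial-zeros (ΣFin≡0⇒zeros a Σa≡0) = refl
coeff*Πfactorial≡ballotProdℤ n (suc k) a Σa≡1+k = begin
    + (coeff n (suc k) a * Πfactorial a)
  ≡⟨ ΣFin-≤ᵇ*≡sumℤ k _ _ (Πfactorial a) term ⟩
    sumℤ (suc k) (λ i → + a i *ᶻ ballotProdℤ 0ℤ k (decAt a i))
  ≡⟨ ballotProdℤ-pascal 0ℤ k a ⟩
    ballotProdℤ 0ℤ (suc k) a -ᶻ 0ℤ
  ≡⟨ ℤ.+-identityʳ _ ⟩
    ballotProdℤ 0ℤ (suc k) a
  ∎
  where
  term : ∀ i → + ((if isZero (a i) then 0 else coeff n k (decAt a i)) * Πfactorial a)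
             ≡ + a i *ᶻ ballotProdℤ 0ℤ k (decAt a i)
  term i with a i in ai≡1+x
  ... | zero  = refl
  ... | suc x = begin
      + (coeff n k a′ * Πfactorial a)
    ≡⟨ cong (λ z → + (coeff n k a′ * z)) (Πfactorial-decAt a i ai≡1+x) ⟩
      + (coeff n k a′ * (suc x * Πfactorial a′))
    ≡⟨ cong +_ (*-CS.x∙yz≈y∙xz (coeff n k a′) (suc x) _) ⟩
      + (suc x * (coeff n k a′ * Πfactorial a′))
    ≡⟨ ℤ.pos-* (suc x) _ ⟩
      + suc x *ᶻ + (coeff n k a′ * Πfactorial a′)
    ≡⟨ cong (+ suc x *ᶻ_) (coeff*Πfactorial≡ballotProdℤ n k a′ Σa′≡k) ⟩
      + suc x *ᶻ ballotProdℤ 0ℤ k a′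
    ∎
    where
    a′ : Fin n → ℕ
    a′ = decAt a i
    Σa′≡k : ΣFin a′ ≡ k
    Σa′≡k = suc-injective (trans (sym (ΣFin-decAt a i ai≡1+x)) Σa≡1+k)

-- Truncated subtraction only bites after a factor 0 has already killed the product.
ballotProd : ∀ {n} → ℕ → ℕ → (Fin n → ℕ) → ℕ
ballotProd t zero    a = 1
ballotProd t (suc m) a = (t + head₀ a) * ballotProd (t + head₀ a ∸ 1) m (tail₀ a)

ballotProdℤ≡ballotProd : ∀ {n} t m (a : Fin n → ℕ) → ballotProdℤ (+ t) m a ≡ + ballotProd t m a
ballotProdℤ≡ballotProd t zero    a = refl
ballotProdℤ≡ballotProd t (suc m) a with t + head₀ a
... | zero  = refl
... | suc x = trans (cong (+ suc x *ᶻ_) (ballotProdℤ≡ballotProd x m (tail₀ a))) (sym (ℤ.pos-* (suc x) _))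

c*Πfactorial≡ballotProd : ∀ n (a : Fin n → ℕ) → ΣFin a ≡ n → c n a * Πfactorial a ≡ ballotProd 0 n a
c*Πfactorial≡ballotProd n a Σa≡n =
  ℤ.+-injective (trans (coeff*Πfactorial≡ballotProdℤ n n a Σa≡n) (ballotProdℤ≡ballotProd 0 n a))

prefixSum : ∀ {n} → ℕ → (Fin n → ℕ) → ℕ
prefixSum zero    a = 0
prefixSum (suc m) a = head₀ a + prefixSum m (tail₀ a)

prefixSum-all : ∀ {n} (a : Fin n → ℕ) → prefixSum n a ≡ ΣFin a
prefixSum-all {zero}  a = refl
prefixSum-all {suc n} a = cong (λ z → a fz + z) (prefixSum-all (a ∘ fs))

prefixSum≤ΣFin : ∀ {n} m (a : Fin n → ℕ) → prefixSum m a ≤ ΣFin a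
prefixSum≤ΣFin zero            a = z≤n
prefixSum≤ΣFin {zero}  (suc m) a = prefixSum≤ΣFin m a
prefixSum≤ΣFin {suc n} (suc m) a = +-monoʳ-≤ (a fz) (prefixSum≤ΣFin m (a ∘ fs))

suffixSum+prefixSum : ∀ {n} k (a : Fin n → ℕ) → suffixSum a k + prefixSum k a ≡ ΣFin a
suffixSum+prefixSum zero            a = +-identityʳ _
suffixSum+prefixSum {zero}  (suc k) a = suffixSum+prefixSum k a
suffixSum+prefixSum {suc n} (suc k) a = begin
    suffixSum a (suc k) + (a fz + prefixSum k (a ∘ fs))
  ≡⟨ cong (_+ (a fz + prefixSum k (a ∘ fs))) suffixSum-fs ⟩
    suffixSum (a ∘ fs) k + (a fz + prefixSum k (a ∘ fs))
  ≡⟨ +-CS.x∙yz≈y∙xz (suffixSum (a ∘ fs) k) (a fz) _ ⟩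
    a fz + (suffixSum (a ∘ fs) k + prefixSum k (a ∘ fs))
  ≡⟨ cong (λ z → a fz + z) (suffixSum+prefixSum k (a ∘ fs)) ⟩
    a fz + ΣFin (a ∘ fs)
  ∎
  where
  suffixSum-fs : suffixSum a (suc k) ≡ suffixSum (a ∘ fs) k
  suffixSum-fs = ΣFin-cong λ i → cong (λ b → if b then a (fs i) else 0) (<ᵇ-suc k (toℕ i))

InA⇒≤prefixSum : ∀ n (a : Fin n → ℕ) → InA n a → ∀ k → k ≤ n → k ≤ prefixSum k a
InA⇒≤prefixSum n a (suffix≤ , Σa≡n) zero    _ = z≤n
InA⇒≤prefixSum n a (suffix≤ , Σa≡n) (suc k) k<n with m≤n⇒m<n∨m≡n k<n
... | inj₂ refl  = ≤-reflexive (sym (trans (prefixSum-all a) Σa≡n))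
... | inj₁ 1+k<n = +-cancelʳ-≤ (suffixSum a (suc k)) (suc k) (prefixSum (suc k) a)
  (≤-trans (+-monoʳ-≤ (suc k) (suffix≤ (suc k) (s≤s z≤n) (<⇒≤pred 1+k<n))) (≤-reflexive total))
  where
  total : suc k + (n ∸ suc k) ≡ prefixSum (suc k) a + suffixSum a (suc k)
  total = begin
    suc k + (n ∸ suc k)                         ≡⟨ m+[n∸m]≡n (<⇒≤ 1+k<n) ⟩
    n                                           ≡⟨ trans (suffixSum+prefixSum (suc k) a) Σa≡n ⟨
    suffixSum a (suc k) + prefixSum (suc k) a   ≡⟨ +-comm (suffixSum a (suc k)) _ ⟩
    prefixSum (suc k) a + suffixSum a (suc k)   ∎

prime∤1 : ∀ {p} → Prime p → p ∤ 1
prime∤1 pp p∣1 = ¬prime[1] (subst Prime (∣1⇒≡1 p∣1) pp)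

prime∤* : ∀ {p m n} → Prime p → p ∤ m → p ∤ n → p ∤ m * n
prime∤* pp p∤m p∤n p∣mn = [ p∤m , p∤n ]′ (euclidsLemma _ _ pp p∣mn)

prime∤ballotProd : ∀ {p} → Prime p → ∀ {n} t m (a : Fin n → ℕ) →
  (∀ j → j < m → j < t + prefixSum (suc j) a × t + prefixSum (suc j) a < p + j) → p ∤ ballotProd t m a
prime∤ballotProd pp t zero    a _ = prime∤1 pp
prime∤ballotProd {p} pp t (suc m) a bounds =
  prime∤* pp (>⇒∤ {{>-nonZero 0<x}} x<p) (prime∤ballotProd pp (x ∸ 1) m (tail₀ a) bounds′)
  where
  x : ℕ
  x = t + head₀ a

  first-factor : t + prefixSum 1 a ≡ x
  first-factor = cong (λ y → t + y) (+-identityʳ (head₀ a))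

  0<x : 0 < x
  0<x = subst (0 <_) first-factor (proj₁ (bounds 0 z<s))

  x<p : x < p
  x<p = subst₂ _<_ first-factor (+-identityʳ p) (proj₂ (bounds 0 z<s))

  later-factor : ∀ j → t + prefixSum (suc (suc j)) a ≡ suc (x ∸ 1 + prefixSum (suc j) (tail₀ a))
  later-factor j = trans (sym (+-assoc t (head₀ a) _))
                         (cong (_+ prefixSum (suc j) (tail₀ a)) (sym (suc-pred x {{>-nonZero 0<x}})))

  bounds′ : ∀ j → j < m →
    j < x ∸ 1 + prefixSum (suc j) (tail₀ a) × x ∸ 1 + prefixSum (suc j) (tail₀ a) < p + j
  bounds′ j j<m with bounds (suc j) (s<s j<m)
  ... | lower , upper = s<s⁻¹ (subst (suc j <_) (later-factor j) lower)
                      , s<s⁻¹ (subst₂ _<_ (later-factor j) (+-suc p j) upper)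

falling : ℕ → ℕ → ℕ
falling t zero    = 1
falling t (suc m) = t * falling (t ∸ 1) m

falling-self : ∀ t → falling t t ≡ t !
falling-self zero    = refl
falling-self (suc t) = cong (suc t *_) (falling-self t)

falling*! : ∀ {t r} → r ≤ t → falling t r * (t ∸ r) ! ≡ t !
falling*! {t}     {zero}  _         = +-identityʳ (t !)
falling*! {suc t} {suc r} (s≤s r≤t) =
  trans (*-assoc (suc t) (falling t r) _) (cong (suc t *_) (falling*! r≤t))

ballotProd-zeros : ∀ {n} t m (a : Fin n → ℕ) → (∀ i → a i ≡ 0) → ballotProd t m a ≡ falling t m
ballotProd-zeros t zero a _ = refl
ballotProd-zeros {zero}  t (suc m) a zeros rewrite +-identityʳ t =
  cong (t *_) (ballotProd-zeros (t ∸ 1) m a zeros)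
ballotProd-zeros {suc n} t (suc m) a zeros rewrite zeros fz | +-identityʳ t =
  cong (t *_) (ballotProd-zeros (t ∸ 1) m (a ∘ fs) (zeros ∘ fs))

c≡1-of-head≡n : ∀ n (a : Fin (suc n) → ℕ) → a fz ≡ suc n → ΣFin a ≡ suc n → c (suc n) a ≡ 1
c≡1-of-head≡n n a a₀≡1+n Σa≡1+n = *-cancelʳ-≡ (c (suc n) a) 1 (suc n !) {{suc n !≢0}} (begin
      c (suc n) a * suc n !
    ≡⟨ cong (c (suc n) a *_) Πa≡ ⟨
      c (suc n) a * Πfactorial a
    ≡⟨ c*Πfactorial≡ballotProd (suc n) a Σa≡1+n ⟩
      a fz * ballotProd (a fz ∸ 1) n (a ∘ fs)
    ≡⟨ cong (λ x → x * ballotProd (x ∸ 1) n (a ∘ fs)) a₀≡1+n ⟩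
      suc n * ballotProd n n (a ∘ fs)
    ≡⟨ cong (suc n *_) (trans (ballotProd-zeros n n (a ∘ fs) tail-zeros) (falling-self n)) ⟩
      suc n !
    ≡⟨ *-identityˡ (suc n !) ⟨
      1 * suc n !
    ∎)
  where
  tail-zeros : ∀ i → a (fs i) ≡ 0
  tail-zeros = ΣFin≡0⇒zeros (a ∘ fs) (+-cancelˡ-≡ (suc n) _ 0
    (trans (cong (_+ ΣFin (a ∘ fs)) (sym a₀≡1+n)) (trans Σa≡1+n (sym (+-identityʳ (suc n))))))
  Πa≡ : Πfactorial a ≡ suc n !
  Πa≡ = trans (cong₂ (λ x y → x ! * y) a₀≡1+n (Πfactorial-zeros tail-zeros)) (*-identityʳ (suc n !))

-- For a ∈ 𝒜_n and a prime p ≥ n, every factor of ballotProd 0 n a lies in [1, p), except when a₁ = n.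
large-prime∤c : ∀ n p → Prime p → suc n ≤ p → (a : Fin (suc n) → ℕ) → InA (suc n) a → p ∤ c (suc n) a
large-prime∤c n p pp n<p a a∈A@(_ , Σa≡1+n) p∣c
  with m≤n⇒m<n∨m≡n (subst (a fz ≤_) Σa≡1+n (m≤m+n (a fz) (ΣFin (a ∘ fs))))
... | inj₂ a₀≡1+n = prime∤1 pp (subst (p ∣_) (c≡1-of-head≡n n a a₀≡1+n Σa≡1+n) p∣c)
... | inj₁ a₀<1+n = prime∤ballotProd pp 0 (suc n) a bounds
  (subst (p ∣_) (c*Πfactorial≡ballotProd (suc n) a Σa≡1+n) (∣m⇒∣m*n (Πfactorial a) p∣c))
  where
  upper : ∀ j → prefixSum (suc j) a < p + j
  upper zero    = subst₂ _<_ (sym (+-identityʳ (a fz))) (sym (+-identityʳ p)) (<-≤-trans a₀<1+n n<p)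
  upper (suc j) = ≤-<-trans (≤-trans (≤-trans (prefixSum≤ΣFin (suc (suc j)) a) (≤-reflexive Σa≡1+n)) n<p)
                            (m<m+n p z<s)

  bounds : ∀ j → j < suc n → j < prefixSum (suc j) a × prefixSum (suc j) a < p + j
  bounds j j<1+n = InA⇒≤prefixSum (suc n) a a∈A (suc j) j<1+n , upper j

InA∧∣c⇒< : ∀ n p → Prime p → (a : Fin n → ℕ) → InA n a → p ∣ c n a → p < n
InA∧∣c⇒< zero    p pp a _   p∣c = contradiction p∣c (prime∤1 pp)
InA∧∣c⇒< (suc n) p pp a a∈A p∣c with p <? suc n
... | yes p<1+n = p<1+n
... | no  p≮1+n = contradiction p∣c (large-prime∤c n p pp (≮⇒≥ p≮1+n) a a∈A)

basis : ∀ {m} → ℕ → Fin m → ℕ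
basis zero    fz     = 1
basis zero    (fs _) = 0
basis (suc r) fz     = 0
basis (suc r) (fs i) = basis r i

ΣFin-basis : ∀ {m} r → r < m → ΣFin (basis {m} r) ≡ 1
ΣFin-basis {suc m} zero    _         = cong suc (ΣFin-zeros {m} λ _ → refl)
ΣFin-basis {suc m} (suc r) (s<s r<m) = ΣFin-basis r r<m

Πfactorial-basis : ∀ {m} r → Πfactorial (basis {m} r) ≡ 1
Πfactorial-basis {zero}  r       = refl
Πfactorial-basis {suc m} zero    = trans (+-identityʳ _) (Πfactorial-zeros {m} λ _ → refl)
Πfactorial-basis {suc m} (suc r) = trans (+-identityʳ _) (Πfactorial-basis {m} r)

ballotProd-basis : ∀ t r → r ≤ t → ballotProd {suc t} t (suc t) (basis r) ≡ falling t r * suc (t ∸ r) !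
ballotProd-basis t zero _ rewrite +-comm t 1 =
  trans (cong (suc t *_) (trans (ballotProd-zeros t t _ λ _ → refl) (falling-self t)))
        (sym (*-identityˡ (suc t !)))
ballotProd-basis (suc t) (suc r) (s≤s r≤t) rewrite +-identityʳ t =
  trans (cong (suc t *_) (ballotProd-basis t r r≤t)) (sym (*-assoc (suc t) (falling t r) _))

-- a = (n − 1) e₁ + e_{n−m+1}: its ballot product is (n − 1)! · m while ∏ aᵢ! = (n − 1)!.
c-attains : ∀ n m → 1 ≤ m → m < n → Σ[ a ∈ (Fin n → ℕ) ] (InA n a × c n a ≡ m)
c-attains (suc (suc t)) (suc k) _ (s≤s (s≤s k≤t)) = a , (suffix≤ , Σa≡n) , cₐ≡1+k
  where
  r : ℕ
  r = t ∸ k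

  r≤t : r ≤ t
  r≤t = m∸n≤m t k

  a : Fin (suc (suc t)) → ℕ
  a = suc t ∷ basis r

  Σa≡n : ΣFin a ≡ suc (suc t)
  Σa≡n = trans (cong (λ z → suc t + z) (ΣFin-basis r (s≤s r≤t))) (+-comm (suc t) 1)

  suffix≤ : ∀ j → 1 ≤ j → j ≤ suc (suc t) ∸ 1 → suffixSum a j ≤ suc (suc t) ∸ j
  suffix≤ (suc j) _ (s≤s j≤t) = ≤-trans suffix≤1 (m<n⇒0<n∸m (s≤s j≤t))
    where
    suffix≤1 : suffixSum a (suc j) ≤ 1
    suffix≤1 = +-cancelʳ-≤ (prefixSum (suc j) a) (suffixSum a (suc j)) 1
      (≤-trans (≤-reflexive (trans (suffixSum+prefixSum (suc j) a) Σa≡n))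
               (+-monoʳ-≤ 1 (m≤m+n (suc t) (prefixSum j (basis r)))))

  cₐ≡1+k : c (suc (suc t)) a ≡ suc k
  cₐ≡1+k = *-cancelʳ-≡ _ (suc k) (suc t !) {{suc t !≢0}} (begin
      c (suc (suc t)) a * suc t !
    ≡⟨ cong (c (suc (suc t)) a *_) Πa≡ ⟨
      c (suc (suc t)) a * Πfactorial a
    ≡⟨ c*Πfactorial≡ballotProd (suc (suc t)) a Σa≡n ⟩
      suc t * ballotProd t (suc t) (basis r)
    ≡⟨ cong (suc t *_) (ballotProd-basis t r r≤t) ⟩
      suc t * (falling t r * (suc (t ∸ r) * (t ∸ r) !))
    ≡⟨ cong (suc t *_) (*-CS.x∙yz≈y∙xz (falling t r) (suc (t ∸ r)) _) ⟩
      suc t * (suc (t ∸ r) * (falling t r * (t ∸ r) !))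
    ≡⟨ *-CS.x∙yz≈y∙xz (suc t) (suc (t ∸ r)) _ ⟩
      suc (t ∸ r) * (suc t * (falling t r * (t ∸ r) !))
    ≡⟨ cong (λ z → suc (t ∸ r) * (suc t * z)) (falling*! r≤t) ⟩
      suc (t ∸ r) * suc t !
    ≡⟨ cong (λ z → suc z * suc t !) (m∸[m∸n]≡n k≤t) ⟩
      suc k * suc t !
    ∎)
    where
    Πa≡ : Πfactorial a ≡ suc t !
    Πa≡ = trans (cong (suc t ! *_) (Πfactorial-basis r)) (*-identityʳ (suc t !))

corollary1 : (n : ℕ) → 1 ≤ n → (p : ℕ) → Prime p →
    (Σ[ m ∈ ℕ ] (1 ≤ m × m ≤ n ∸ 1 × p ∣ m))
      ⇔ (Σ[ a ∈ (Fin n → ℕ) ] (InA n a × p ∣ c n a))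
corollary1 (suc n) _ p pp = mk⇔ to from
  where
  1≤p : 1 ≤ p
  1≤p = >-nonZero⁻¹ p {{prime⇒nonZero pp}}

  Multiples Coefficients : Set
  Multiples    = Σ[ m ∈ ℕ ] (1 ≤ m × m ≤ n × p ∣ m)
  Coefficients = Σ[ a ∈ (Fin (suc n) → ℕ) ] (InA (suc n) a × p ∣ c (suc n) a)

  to : Multiples → Coefficients
  to (m , 1≤m , m≤n , p∣m) with c-attains (suc n) p 1≤p (s≤s (≤-trans (∣⇒≤ {{>-nonZero 1≤m}} p∣m) m≤n))
  ... | a , a∈A , cₐ≡p = a , a∈A , ∣-reflexive (sym cₐ≡p)

  from : Coefficients → Multiples
  from (a , a∈A , p∣c) = p , 1≤p , <⇒≤pred (InA∧∣c⇒< (suc n) p pp a a∈A p∣c) , ∣-refl
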